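{- If $n\ge 2$, then $\chi_i(S_{C_4}^n)=3$ and $S_{C_4}^n$ is not perfect injectively colorable.
   Context: For a graph $G$ and integer $n\ge1$, the generalized Sierpiński graph $S_G^n$ has vertex set $V(G)^n$, where $(u_1,\ldots,u_n)$ and $(v_1,\ldots,v_n)$ are adjacent if there exists $i\in[n]$ such that $u_j=v_j$ for $j<i$, $u_iv_i\in E(G)$, and $u_j=v_i$ and $v_j=u_i$ for all $j>i$. $C_4$ is the cycle on four vertices. An injective $k$-coloring of a graph $G$ is a map $f:V(G)\to\{1,\dots,k\}$ such that no vertex has two neighbors $u\neq w$ with $f(u)=f(w)$; $\chi_i(G)$ is the least such $k$. A set $B\subseteq V(G)$ is an open packing if $N(u)\cap N(v)=\emptyset$ for all distinct $u,v\in B$; $\rho^{\rm o}(G)$ is the maximum cardinality of an open packing. $G$ is perfect injectively colorable if it has an injective coloring in which every color class is an open packing of cardinality $\rho^{\rm o}(G)$. -}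

module Defs where

open import Data.Nat using (ℕ; _≤_; _≥_)
open import Data.Fin using (Fin; zero; suc) renaming (_<_ to _<ᶠ_)
open import Data.Vec using (Vec; lookup)
open import Data.List using (List; length)
open import Data.List.Membership.Propositional using (_∈_)
open import Data.List.Relation.Unary.Unique.Propositional using (Unique)
open import Data.Product using (Σ; ∃; _×_; Σ-syntax; ∃-syntax)
open import Relation.Binary.PropositionalEquality using (_≡_; _≢_)
open import Relation.Nullary using (¬_)
open import Function.Bundles using (_⇔_)

record Graph : Set₁ where
  field
    V   : Set
    Adj : V → V → Set
open Graph public

data C4Adj : Fin 4 → Fin 4 → Set where
  e01 : C4Adj zero (suc zero)
  e10 : C4Adj (suc zero) zero
  e12 : C4Adj (suc zero) (suc (suc zero))
  e21 : C4Adj (suc (suc zero)) (suc zero)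
  e23 : C4Adj (suc (suc zero)) (suc (suc (suc zero)))
  e32 : C4Adj (suc (suc (suc zero))) (suc (suc zero))
  e30 : C4Adj (suc (suc (suc zero))) zero
  e03 : C4Adj zero (suc (suc (suc zero)))

C4 : Graph
C4 = record { V = Fin 4 ; Adj = C4Adj }

SierpinskiAdj : {k : ℕ} → (Fin k → Fin k → Set) → (n : ℕ) → Vec (Fin k) n → Vec (Fin k) n → Set
SierpinskiAdj A n u v =
  Σ[ i ∈ Fin n ]
    ((∀ (j : Fin n) → j <ᶠ i → lookup u j ≡ lookup v j)
    × A (lookup u i) (lookup v i)
    × (∀ (j : Fin n) → i <ᶠ j → (lookup u j ≡ lookup v i) × (lookup v j ≡ lookup u i)))

Sierpinski : {k : ℕ} → (Fin k → Fin k → Set) → ℕ → Graph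
Sierpinski {k} A n = record { V = Vec (Fin k) n ; Adj = SierpinskiAdj A n }

module _ (G : Graph) where

  IsInjectiveColoring : {k : ℕ} → (V G → Fin k) → Set
  IsInjectiveColoring f =
    ∀ (v u w : V G) → Adj G v u → Adj G v w → u ≢ w → f u ≢ f w

  HasInjectiveColoring : ℕ → Set
  HasInjectiveColoring k = Σ[ f ∈ (V G → Fin k) ] IsInjectiveColoring f

  InjectiveChromaticNumber≡ : ℕ → Set
  InjectiveChromaticNumber≡ k =
    HasInjectiveColoring k × (∀ m → HasInjectiveColoring m → k ≤ m)

  IsOpenPacking : (V G → Set) → Set
  IsOpenPacking B =
    ∀ (u v : V G) → B u → B v → u ≢ v → ¬ (∃[ w ] (Adj G u w × Adj G v w))

  -- finite sets of vertices given as duplicate-free lists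
  IsOpenPackingList : List (V G) → Set
  IsOpenPackingList xs = Unique xs × IsOpenPacking (λ v → v ∈ xs)

  OpenPackingNumber≡ : ℕ → Set
  OpenPackingNumber≡ r =
    (Σ[ xs ∈ List (V G) ] (IsOpenPackingList xs × length xs ≡ r))
    × (∀ (xs : List (V G)) → IsOpenPackingList xs → length xs ≤ r)

  ClassIsOpenPackingOfSize : {k : ℕ} → (V G → Fin k) → Fin k → ℕ → Set
  ClassIsOpenPackingOfSize f c r =
    IsOpenPacking (λ v → f v ≡ c)
    × (Σ[ xs ∈ List (V G) ] (Unique xs × (∀ v → (v ∈ xs) ⇔ (f v ≡ c)) × length xs ≡ r))

  PerfectInjectivelyColorable : Set
  PerfectInjectivelyColorable =
    Σ[ k ∈ ℕ ] Σ[ f ∈ (V G → Fin k) ]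
      (IsInjectiveColoring f
      × Σ[ r ∈ ℕ ] (OpenPackingNumber≡ r × (∀ (c : Fin k) → ClassIsOpenPackingOfSize f c r)))

-- A neighbour of x v in S^(n+1) is either x u with u a neighbour of v in S^n, or, when
-- v = y^n is extreme, the bridge neighbour y x^n. Colouring a word by a fixed function of its
-- last two letters is therefore injective on every S^(2+m) as soon as it is injective on S^2
-- and separates bridge neighbours; both are finite checks. The vertex 0 1^(n-1) has three
-- neighbours, so χ_i ≥ 3. The six words 01, 02, 12, 21, 31, 32 form an open packing of S^2
-- without extreme vertices, and prefixing every letter preserves this, so
-- ρ^o(S^(2+m)) ≥ 6·4^m. A perfect injective colouring with k ≥ 3 colours would then have
-- k disjoint classes of that size among 4^(2+m) = 16·4^m vertices, but 18·4^m > 16·4^m.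
module Submission where

open import Defs
open import Data.Nat using (ℕ; zero; suc; _+_; _*_; _^_; _≤_; _≥_; z≤n; s≤s; z<s; s<s)
open import Data.Nat.Properties
  using (m<m+n; *-assoc; *-monoʳ-≤; *-monoˡ-≤; *-monoˡ-<; <-irrefl; m^n≢0; module ≤-Reasoning)
open import Data.Fin using (Fin; zero; suc; #_; funToFin; finToFun)
open import Data.Fin.Properties using (_≟_; _<?_; all?; any?; injective⇒≤; finToFun-funToFin)
open import Data.Vec using (Vec; []; _∷_; _∷ʳ_; lookup; replicate)
open import Data.Vec.Properties
  using (≡-dec; lookup-replicate; ∷-injective; ∷-injectiveˡ; ∷-injectiveʳ; ∷ʳ-injectiveʳ)
open import Data.List as List using (List; []; _∷_; _++_; length; allFin; cartesianProductWith)
open import Data.List.Properties using (length-++; length-map; length-tabulate)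
open import Data.List.Membership.Propositional using (_∈_)
open import Data.List.Membership.Propositional.Properties using (∈-lookup)
open import Data.List.Membership.DecPropositional (≡-dec {n = 2} (_≟_ {4})) using (_∈?_)
open import Data.List.Relation.Unary.All as All using ()
open import Data.List.Relation.Unary.All.Properties as All using ()
open import Data.List.Relation.Unary.AllPairs.Properties as AllPairs using ()
open import Data.List.Relation.Unary.Any.Properties using (cartesianProductWith⁻)
open import Data.List.Relation.Unary.AllPairs using (_∷_)
open import Data.List.Relation.Unary.Unique.Propositional using (Unique)
open import Data.List.Relation.Unary.Unique.Propositional.Properties
  using (concat⁺; cartesianProductWith⁺; allFin⁺)
open import Data.List.Relation.Unary.Unique.DecPropositional (≡-dec {n = 2} (_≟_ {4}))
  using (unique?)
open import Data.List.Relation.Binary.Disjoint.Propositional using (Disjoint)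
open import Data.Product using (_×_; _,_; proj₁; proj₂; ∃-syntax)
open import Data.Sum using (_⊎_; inj₁; inj₂)
open import Function using (_∘_; id)
open import Function.Bundles using (Equivalence)
open import Relation.Binary.Definitions using (Decidable)
open import Relation.Binary.PropositionalEquality
  using (_≡_; _≢_; _≗_; refl; sym; trans; cong; cong₂; subst; module ≡-Reasoning)
open import Relation.Nullary using (¬_; Dec; yes; no; map′; ¬?; _×-dec_; _→-dec_; contradiction)
open import Relation.Nullary.Decidable using (from-yes)

allVec? : ∀ {k n p} {P : Vec (Fin k) n → Set p} → (∀ v → Dec (P v)) → Dec (∀ v → P v)
allVec? {n = zero} P? = map′ (λ p → λ { [] → p }) (λ h → h []) (P? [])
allVec? {n = suc n} {P = P} P? =
  map′ (λ h → λ { (x ∷ v) → h x v }) (λ h x v → h (x ∷ v))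
       (all? λ x → allVec? {P = P ∘ (x ∷_)} (P? ∘ (x ∷_)))

≗-lookup⇒≡ : ∀ {a} {A : Set a} {n} {u v : Vec A n} → lookup u ≗ lookup v → u ≡ v
≗-lookup⇒≡ {u = []} {[]} _ = refl
≗-lookup⇒≡ {u = x ∷ u} {y ∷ v} eq = cong₂ _∷_ (eq zero) (≗-lookup⇒≡ (eq ∘ suc))

encode : ∀ {k n} → Vec (Fin k) n → Fin (k ^ n)
encode = funToFin ∘ lookup

encode-injective : ∀ {k n} {u v : Vec (Fin k) n} → encode u ≡ encode v → u ≡ v
encode-injective {u = u} {v} eq = ≗-lookup⇒≡ λ j → begin
  lookup u j                       ≡⟨ finToFun-funToFin (lookup u) j ⟨
  finToFun (encode u) j            ≡⟨ cong (λ c → finToFun c j) eq ⟩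
  finToFun (encode v) j            ≡⟨ finToFun-funToFin (lookup v) j ⟩
  lookup v j                       ∎
  where open ≡-Reasoning

unique⇒lookup-injective : ∀ {a} {A : Set a} {xs : List A} → Unique xs →
                   ∀ {i j} → List.lookup xs i ≡ List.lookup xs j → i ≡ j
unique⇒lookup-injective (_ ∷ _) {zero} {zero} _ = refl
unique⇒lookup-injective (x∉xs ∷ _) {zero} {suc j} eq =
  contradiction eq (All.lookup x∉xs (∈-lookup j))
unique⇒lookup-injective (x∉xs ∷ _) {suc i} {zero} eq =
  contradiction (sym eq) (All.lookup x∉xs (∈-lookup i))
unique⇒lookup-injective (_ ∷ xs!) {suc i} {suc j} eq = cong suc (unique⇒lookup-injective xs! eq)

unique⇒length≤ : ∀ {k n} {xs : List (Vec (Fin k) n)} → Unique xs → length xs ≤ k ^ n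
unique⇒length≤ xs! = injective⇒≤ (unique⇒lookup-injective xs! ∘ encode-injective)

length-cartesianProductWith : ∀ {a b c} {A : Set a} {B : Set b} {C : Set c}
  (f : A → B → C) xs ys → length (cartesianProductWith f xs ys) ≡ length xs * length ys
length-cartesianProductWith f [] ys = refl
length-cartesianProductWith f (x ∷ xs) ys = begin
  length (List.map (f x) ys ++ cartesianProductWith f xs ys)
    ≡⟨ length-++ (List.map (f x) ys) ⟩
  length (List.map (f x) ys) + length (cartesianProductWith f xs ys)
    ≡⟨ cong₂ _+_ (length-map (f x) ys) (length-cartesianProductWith f xs ys) ⟩
  length ys + length xs * length ys
    ∎
  where open ≡-Reasoning

length-concat-tabulate : ∀ {a} {A : Set a} {k r} (xss : Fin k → List A) →
  (∀ c → length (xss c) ≡ r) → length (List.concat (List.tabulate xss)) ≡ k * r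
length-concat-tabulate {k = zero} xss _ = refl
length-concat-tabulate {k = suc k} xss ∣xss∣≡r =
  trans (length-++ (xss zero))
        (cong₂ _+_ (∣xss∣≡r zero) (length-concat-tabulate (xss ∘ suc) (∣xss∣≡r ∘ suc)))

-- Injective colourings

distinct³⇒3≤ : ∀ {k} {a b c : Fin k} → a ≢ b → a ≢ c → b ≢ c → 3 ≤ k
distinct³⇒3≤ {suc (suc (suc _))} _ _ _ = s≤s (s≤s (s≤s z≤n))
distinct³⇒3≤ {1} {zero} {zero} a≢b _ _ = contradiction refl a≢b
distinct³⇒3≤ {2} {zero} {zero} a≢b _ _ = contradiction refl a≢b
distinct³⇒3≤ {2} {suc zero} {suc zero} a≢b _ _ = contradiction refl a≢b
distinct³⇒3≤ {2} {zero} {suc zero} {zero} _ a≢c _ = contradiction refl a≢c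
distinct³⇒3≤ {2} {zero} {suc zero} {suc zero} _ _ b≢c = contradiction refl b≢c
distinct³⇒3≤ {2} {suc zero} {zero} {zero} _ _ b≢c = contradiction refl b≢c
distinct³⇒3≤ {2} {suc zero} {zero} {suc zero} _ a≢c _ = contradiction refl a≢c

module _ (G : Graph) {k : ℕ} {f : V G → Fin k} where

  threeNeighbours⇒3≤ : IsInjectiveColoring G f → ∀ {v u₁ u₂ u₃} →
    Adj G v u₁ → Adj G v u₂ → Adj G v u₃ → u₁ ≢ u₂ → u₁ ≢ u₃ → u₂ ≢ u₃ → 3 ≤ k
  threeNeighbours⇒3≤ f-inj a₁ a₂ a₃ u₁≢u₂ u₁≢u₃ u₂≢u₃ =
    distinct³⇒3≤ (f-inj _ _ _ a₁ a₂ u₁≢u₂) (f-inj _ _ _ a₁ a₃ u₁≢u₃) (f-inj _ _ _ a₂ a₃ u₂≢u₃)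

  classesOfSize⇒k*r≤ : ∀ {N r} → (∀ (xs : List (V G)) → Unique xs → length xs ≤ N) →
    (∀ c → ClassIsOpenPackingOfSize G f c r) → k * r ≤ N
  classesOfSize⇒k*r≤ {N} {r} bound classes =
    subst (_≤ N) (length-concat-tabulate listing length-listing)
      (bound _ (concat⁺ (All.tabulate⁺ listing-unique) (AllPairs.tabulate⁺ listings-disjoint)))
    where
    listing : Fin k → List (V G)
    listing c = proj₁ (proj₂ (classes c))

    listing-unique : ∀ c → Unique (listing c)
    listing-unique c = proj₁ (proj₂ (proj₂ (classes c)))

    length-listing : ∀ c → length (listing c) ≡ r
    length-listing c = proj₂ (proj₂ (proj₂ (proj₂ (classes c))))

    colour-listing : ∀ c {v} → v ∈ listing c → f v ≡ c
    colour-listing c {v} = Equivalence.to (proj₁ (proj₂ (proj₂ (proj₂ (classes c)))) v)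

    listings-disjoint : ∀ {c d} → c ≢ d → Disjoint (listing c) (listing d)
    listings-disjoint {c} {d} c≢d (v∈c , v∈d) =
      c≢d (trans (sym (colour-listing c v∈c)) (colour-listing d v∈d))

-- Generalized Sierpiński graphs

Extreme : ∀ {k n} → Vec (Fin k) n → Set
Extreme {n = n} v = ∃[ a ] v ≡ replicate n a

extreme? : ∀ {k n} (v : Vec (Fin k) n) → Dec (Extreme v)
extreme? v = any? λ a → ≡-dec _≟_ v (replicate _ a)

NonExtreme : ∀ {k n} → List (Vec (Fin k) n) → Set
NonExtreme P = ∀ {v} → v ∈ P → ¬ Extreme v

prefixAll : ∀ {k n} → List (Vec (Fin k) n) → List (Vec (Fin k) (suc n))
prefixAll {k} = cartesianProductWith _∷_ (allFin k)

module _ {k n : ℕ} {P : List (Vec (Fin k) n)} where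

  ∈-prefixAll⁻ : ∀ {y u} → y ∷ u ∈ prefixAll P → u ∈ P
  ∈-prefixAll⁻ = proj₂ ∘ cartesianProductWith⁻ _∷_ ∷-injective (allFin k) P

  prefixAll-unique : Unique P → Unique (prefixAll P)
  prefixAll-unique = cartesianProductWith⁺ _∷_ ∷-injective (allFin⁺ k)

  length-prefixAll : length (prefixAll P) ≡ k * length P
  length-prefixAll =
    trans (length-cartesianProductWith _∷_ (allFin k) P)
          (cong (_* length P) (length-tabulate {n = k} id))

  prefixAll-nonExtreme : NonExtreme P → NonExtreme (prefixAll P)
  prefixAll-nonExtreme noExt {y ∷ u} yu∈ (a , yu≡) = noExt (∈-prefixAll⁻ yu∈) (a , ∷-injectiveʳ yu≡)

module _ {k : ℕ} (A : Fin k → Fin k → Set) where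

  private
    S : (n : ℕ) → Vec (Fin k) n → Vec (Fin k) n → Set
    S = SierpinskiAdj A

  ∷-adjacent : ∀ {n x} {u v : Vec (Fin k) n} → S n u v → S (suc n) (x ∷ u) (x ∷ v)
  ∷-adjacent (i , before , a , after) =
      suc i
    , (λ { zero _ → refl ; (suc j) (s<s j<i) → before j j<i })
    , a
    , (λ { (suc j) (s<s i<j) → after j i<j })

  bridge-adjacent : ∀ {n x y} → A x y → S (suc n) (x ∷ replicate n y) (y ∷ replicate n x)
  bridge-adjacent {x = x} {y} a =
    zero , (λ _ ()) , a , λ { (suc j) _ → lookup-replicate j y , lookup-replicate j x }

  ∷-adjacent⁻ : ∀ {n x y} {u v : Vec (Fin k) n} → S (suc n) (x ∷ u) (y ∷ v) →
    (x ≡ y × S n u v) ⊎ (A x y × u ≡ replicate n y × v ≡ replicate n x)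
  ∷-adjacent⁻ {x = x} {y} {u} {v} (zero , _ , a , after) =
    inj₂ (a , constant (proj₁ ∘ after-tail) , constant (proj₂ ∘ after-tail))
    where
    after-tail : ∀ j → (lookup u j ≡ y) × (lookup v j ≡ x)
    after-tail j = after (suc j) z<s

    constant : ∀ {n c} {w : Vec (Fin k) n} → (∀ j → lookup w j ≡ c) → w ≡ replicate n c
    constant {c = c} eq = ≗-lookup⇒≡ λ j → trans (eq j) (sym (lookup-replicate j c))
  ∷-adjacent⁻ (suc i , before , a , after) =
    inj₁ ( before zero z<s
         , i , (λ j j<i → before (suc j) (s<s j<i)) , a , (λ j i<j → after (suc j) (s<s i<j)))

  extreme-adjacent : ∀ {n y t} → A y t → S (suc n) (replicate (suc n) y) (replicate n y ∷ʳ t)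
  extreme-adjacent {zero} a = bridge-adjacent a
  extreme-adjacent {suc n} a = ∷-adjacent (extreme-adjacent a)

  extreme-adjacent⁻ : (∀ {x} → ¬ A x x) → ∀ {n y v} → S (suc n) (replicate (suc n) y) v →
    ∃[ t ] (A y t × v ≡ replicate n y ∷ʳ t)
  extreme-adjacent⁻ irrefl {zero} {v = t ∷ []} yv with ∷-adjacent⁻ yv
  ... | inj₁ (_ , () , _)
  ... | inj₂ (a , _ , _) = t , a , refl
  extreme-adjacent⁻ irrefl {suc n} {v = c ∷ v} yv with ∷-adjacent⁻ yv
  ... | inj₁ (refl , yv′) = let t , a , v≡ = extreme-adjacent⁻ irrefl yv′ in t , a , cong (c ∷_) v≡
  ... | inj₂ (a , y≡c , _) = contradiction (subst (A _) (sym (∷-injectiveˡ y≡c)) a) irrefl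

  sierpinskiAdj? : Decidable A → ∀ {n} → Decidable (S n)
  sierpinskiAdj? A? u v = any? λ i →
         all? (λ j → j <? i →-dec lookup u j ≟ lookup v j)
    ×-dec A? (lookup u i) (lookup v i)
    ×-dec all? (λ j → i <? j →-dec (lookup u j ≟ lookup v i ×-dec lookup v j ≟ lookup u i))

  prefixAll-isOpenPacking : ∀ {n} {P : List (Vec (Fin k) n)} → NonExtreme P →
    IsOpenPacking (Sierpinski A n) (_∈ P) → IsOpenPacking (Sierpinski A (suc n)) (_∈ prefixAll P)
  prefixAll-isOpenPacking noExt isPacking (x ∷ u) (y ∷ v) xu∈ yv∈ xu≢yv (z ∷ w , xu~zw , yv~zw)
    with ∷-adjacent⁻ xu~zw | ∷-adjacent⁻ yv~zw
  ... | inj₂ (_ , u≡ , _) | _ = noExt (∈-prefixAll⁻ xu∈) (z , u≡)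
  ... | inj₁ _ | inj₂ (_ , v≡ , _) = noExt (∈-prefixAll⁻ yv∈) (z , v≡)
  ... | inj₁ (refl , u~w) | inj₁ (refl , v~w) =
    isPacking u v (∈-prefixAll⁻ xu∈) (∈-prefixAll⁻ yv∈) (xu≢yv ∘ cong (x ∷_)) (w , u~w , v~w)

-- The cycle C4

c4Adj? : Decidable C4Adj
c4Adj? zero                   zero                   = no λ ()
c4Adj? zero                   (suc zero)             = yes e01
c4Adj? zero                   (suc (suc zero))       = no λ ()
c4Adj? zero                   (suc (suc (suc zero))) = yes e03
c4Adj? (suc zero)             zero                   = yes e10
c4Adj? (suc zero)             (suc zero)             = no λ ()
c4Adj? (suc zero)             (suc (suc zero))       = yes e12
c4Adj? (suc zero)             (suc (suc (suc zero))) = no λ ()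
c4Adj? (suc (suc zero))       zero                   = no λ ()
c4Adj? (suc (suc zero))       (suc zero)             = yes e21
c4Adj? (suc (suc zero))       (suc (suc zero))       = no λ ()
c4Adj? (suc (suc zero))       (suc (suc (suc zero))) = yes e23
c4Adj? (suc (suc (suc zero))) zero                   = yes e30
c4Adj? (suc (suc (suc zero))) (suc zero)             = no λ ()
c4Adj? (suc (suc (suc zero))) (suc (suc zero))       = yes e32
c4Adj? (suc (suc (suc zero))) (suc (suc (suc zero))) = no λ ()

c4-irreflexive : ∀ {x} → ¬ C4Adj x x
c4-irreflexive ()

pairColour : Fin 4 → Fin 4 → Fin 3
pairColour x y = lookup (lookup table x) y
  where
  table : Vec (Vec (Fin 3) 4) 4
  table = (# 0 ∷ # 0 ∷ # 1 ∷ # 1 ∷ [])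
        ∷ (# 2 ∷ # 2 ∷ # 1 ∷ # 1 ∷ [])
        ∷ (# 2 ∷ # 0 ∷ # 0 ∷ # 1 ∷ [])
        ∷ (# 2 ∷ # 0 ∷ # 1 ∷ # 2 ∷ [])
        ∷ []

colour : ∀ {m} → Vec (Fin 4) (2 + m) → Fin 3
colour (x ∷ y ∷ []) = pairColour x y
colour (_ ∷ y ∷ z ∷ v) = colour (y ∷ z ∷ v)

colour-∷ : ∀ {m} x (u : Vec (Fin 4) (2 + m)) → colour (x ∷ u) ≡ colour u
colour-∷ x (_ ∷ _ ∷ _) = refl

colour-replicate : ∀ m x → colour (replicate (2 + m) x) ≡ pairColour x x
colour-replicate zero x = refl
colour-replicate (suc m) x = trans (colour-∷ x (replicate (2 + m) x)) (colour-replicate m x)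

colour-extreme-∷ʳ : ∀ m y t → colour (replicate (suc m) y ∷ʳ t) ≡ pairColour y t
colour-extreme-∷ʳ zero y t = refl
colour-extreme-∷ʳ (suc m) y t =
  trans (colour-∷ y (replicate (suc m) y ∷ʳ t)) (colour-extreme-∷ʳ m y t)

colour₂-injective : IsInjectiveColoring (Sierpinski C4Adj 2) colour
colour₂-injective = from-yes (allVec? {n = 2} λ v → allVec? λ u → allVec? λ w →
  sierpinskiAdj? C4Adj c4Adj? v u →-dec sierpinskiAdj? C4Adj c4Adj? v w →-dec
  ¬? (≡-dec _≟_ u w) →-dec ¬? (colour u ≟ colour w))

pairColour-path : ∀ x z t → C4Adj x z → C4Adj z t → pairColour z t ≢ pairColour x x
pairColour-path = from-yes (all? λ x → all? λ z → all? λ t →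
  c4Adj? x z →-dec c4Adj? z t →-dec ¬? (pairColour z t ≟ pairColour x x))

colour-bridge : ∀ m {x z} (u : Vec (Fin 4) (2 + m)) → C4Adj x z →
  SierpinskiAdj C4Adj (2 + m) (replicate (2 + m) z) u → colour u ≢ colour (replicate (2 + m) x)
colour-bridge m {x} {z} u x~z zz~u same with extreme-adjacent⁻ C4Adj c4-irreflexive {v = u} zz~u
... | t , z~t , refl = pairColour-path x z t x~z z~t (begin
  pairColour z t                       ≡⟨ colour-extreme-∷ʳ m z t ⟨
  colour (replicate (suc m) z ∷ʳ t)    ≡⟨ same ⟩
  colour (replicate (2 + m) x)         ≡⟨ colour-replicate m x ⟩
  pairColour x x                       ∎)
  where open ≡-Reasoning

colour-injective : ∀ m → IsInjectiveColoring (Sierpinski C4Adj (2 + m)) colour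
colour-injective zero = colour₂-injective
colour-injective (suc m) (x ∷ v) (y ∷ u) (z ∷ w) xv~yu xv~zw yu≢zw same
  with ∷-adjacent⁻ C4Adj xv~yu | ∷-adjacent⁻ C4Adj xv~zw
... | inj₁ (refl , v~u) | inj₁ (refl , v~w) =
  colour-injective m v u w v~u v~w (yu≢zw ∘ cong (x ∷_)) (begin
    colour u          ≡⟨ colour-∷ x u ⟨
    colour (x ∷ u)    ≡⟨ same ⟩
    colour (x ∷ w)    ≡⟨ colour-∷ x w ⟩
    colour w          ∎)
  where open ≡-Reasoning
... | inj₁ (refl , v~u) | inj₂ (x~z , refl , refl) =
  colour-bridge m u x~z v~u (trans (sym (colour-∷ x u)) same)
... | inj₂ (x~y , refl , refl) | inj₁ (refl , v~w) =
  colour-bridge m w x~y v~w (trans (sym (colour-∷ x w)) (sym same))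
... | inj₂ (_ , refl , refl) | inj₂ (_ , refl , refl) = yu≢zw refl

injectiveColouring⇒3≤ : ∀ m {k} {f : Vec (Fin 4) (2 + m) → Fin k} →
  IsInjectiveColoring (Sierpinski C4Adj (2 + m)) f → 3 ≤ k
injectiveColouring⇒3≤ m f-inj =
  threeNeighbours⇒3≤ (Sierpinski C4Adj (2 + m)) f-inj
    {v = # 0 ∷ replicate (suc m) (# 1)}
    {u₁ = # 0 ∷ (replicate m (# 1) ∷ʳ # 0)}
    {u₂ = # 0 ∷ (replicate m (# 1) ∷ʳ # 2)}
    {u₃ = # 1 ∷ replicate (suc m) (# 0)}
    (∷-adjacent C4Adj (extreme-adjacent C4Adj e10))
    (∷-adjacent C4Adj (extreme-adjacent C4Adj e12))
    (bridge-adjacent C4Adj e01)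
    (λ eq → contradiction (∷ʳ-injectiveʳ _ _ (∷-injectiveʳ eq)) λ ())
    (λ ())
    (λ ())

packing₂ : List (Vec (Fin 4) 2)
packing₂ = (# 0 ∷ # 1 ∷ []) ∷ (# 0 ∷ # 2 ∷ []) ∷ (# 1 ∷ # 2 ∷ [])
         ∷ (# 2 ∷ # 1 ∷ []) ∷ (# 3 ∷ # 1 ∷ []) ∷ (# 3 ∷ # 2 ∷ []) ∷ []

packing₂-unique : Unique packing₂
packing₂-unique = from-yes (unique? packing₂)

packing₂-nonExtreme : NonExtreme packing₂
packing₂-nonExtreme {v} = from-yes (allVec? λ v → v ∈? packing₂ →-dec ¬? (extreme? v)) v

packing₂-isOpenPacking : IsOpenPacking (Sierpinski C4Adj 2) (_∈ packing₂)
packing₂-isOpenPacking u v u∈ v∈ u≢v (w , u~w , v~w) = u≢v (sharedNeighbour⇒≡ u v w u∈ v∈ u~w v~w)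
  where
  sharedNeighbour⇒≡ : ∀ u v w → u ∈ packing₂ → v ∈ packing₂ →
    SierpinskiAdj C4Adj 2 u w → SierpinskiAdj C4Adj 2 v w → u ≡ v
  sharedNeighbour⇒≡ = from-yes (allVec? λ u → allVec? λ v → allVec? λ w →
    u ∈? packing₂ →-dec v ∈? packing₂ →-dec sierpinskiAdj? C4Adj c4Adj? u w →-dec
    sierpinskiAdj? C4Adj c4Adj? v w →-dec ≡-dec _≟_ u v)

packing : ∀ m → List (Vec (Fin 4) (2 + m))
packing zero = packing₂
packing (suc m) = prefixAll (packing m)

packing-nonExtreme : ∀ m → NonExtreme (packing m)
packing-nonExtreme zero = packing₂-nonExtreme
packing-nonExtreme (suc m) = prefixAll-nonExtreme (packing-nonExtreme m)

packing-isOpenPackingList : ∀ m → IsOpenPackingList (Sierpinski C4Adj (2 + m)) (packing m)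
packing-isOpenPackingList zero = packing₂-unique , packing₂-isOpenPacking
packing-isOpenPackingList (suc m) =
  let unique , isOpenPacking = packing-isOpenPackingList m
  in prefixAll-unique unique , prefixAll-isOpenPacking C4Adj (packing-nonExtreme m) isOpenPacking

length-packing : ∀ m → length (packing m) ≡ 6 * 4 ^ m
length-packing zero = refl
length-packing (suc m) = begin
  length (prefixAll (packing m))   ≡⟨ length-prefixAll {P = packing m} ⟩
  4 * length (packing m)           ≡⟨ cong (4 *_) (length-packing m) ⟩
  4 * (6 * 4 ^ m)                  ≡⟨ *-assoc 4 6 (4 ^ m) ⟨
  6 * 4 * 4 ^ m                    ≡⟨ *-assoc 6 4 (4 ^ m) ⟩
  6 * 4 ^ suc m                    ∎
  where open ≡-Reasoning

packing-doesNotFit : ∀ m {k r} → 3 ≤ k → 6 * 4 ^ m ≤ r → ¬ (k * r ≤ 4 ^ (2 + m))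
packing-doesNotFit m {k} {r} 3≤k ρ≥ kr≤ = <-irrefl refl (begin-strict
  16 * 4 ^ m        <⟨ *-monoˡ-< (4 ^ m) {{m^n≢0 4 m}} (m<m+n 16 {2} z<s) ⟩
  3 * 6 * 4 ^ m     ≡⟨ *-assoc 3 6 (4 ^ m) ⟩
  3 * (6 * 4 ^ m)   ≤⟨ *-monoʳ-≤ 3 ρ≥ ⟩
  3 * r             ≤⟨ *-monoˡ-≤ r 3≤k ⟩
  k * r             ≤⟨ kr≤ ⟩
  4 ^ (2 + m)       ≡⟨ *-assoc 4 4 (4 ^ m) ⟨
  16 * 4 ^ m        ∎)
  where open ≤-Reasoning

proposition3p3 : (n : ℕ) → n ≥ 2 →
    InjectiveChromaticNumber≡ (Sierpinski C4Adj n) 3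
    × ¬ PerfectInjectivelyColorable (Sierpinski C4Adj n)
proposition3p3 zero ()
proposition3p3 (suc zero) (s≤s ())
proposition3p3 (suc (suc m)) _ =
    ((colour , colour-injective m) , λ _ (_ , f-inj) → injectiveColouring⇒3≤ m f-inj)
  , λ (_ , f , f-inj , r , (_ , maximal) , classes) →
      packing-doesNotFit m (injectiveColouring⇒3≤ m f-inj)
        (subst (_≤ r) (length-packing m) (maximal (packing m) (packing-isOpenPackingList m)))
        (classesOfSize⇒k*r≤ (Sierpinski C4Adj (2 + m)) (λ _ → unique⇒length≤) classes)
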